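{- Let $\mathcal{N}$ be a tree-child network with no $3$-cycles, and let $e$ be a reticulation arc of $\mathcal{N}$. Suppose that $\mathcal{N}\backslash e$ has a $3$-cycle with reticulation arcs $f$ and $f'$. Then each of $\mathcal{N}\backslash\{e,f\}$ and $\mathcal{N}\backslash\{e,f'\}$ is tree-child and has no $3$-cycles.
   Context: A (rooted binary) phylogenetic network on a non-empty finite set $X$ is a rooted acyclic directed graph with no parallel arcs such that the root has in-degree $0$ and out-degree $2$, the vertices of out-degree $0$ (leaves) are exactly $X$, and every other vertex has in-degree $1$ and out-degree $2$ (tree vertex) or in-degree $2$ and out-degree $1$ (reticulation); if $|X|=1$ the network may be a single vertex. Arcs into reticulations are reticulation arcs. A network is tree-child if every non-leaf vertex has a child that is a tree vertex or a leaf. A $3$-cycle is a cycle of length $3$ in the underlying undirected graph. For a tree-child network $\mathcal{N}$ with root $\rho$ and a reticulation arc $e=(u,v)$, $\mathcal{N}\backslash e$ denotes the network obtained by deleting $e$ and then, if $u\ne\rho$, suppressing the two resulting vertices of in-degree one and out-degree one, or, if $u=\rho$, suppressing the resulting vertex of in-degree one and out-degree one and deleting $u$; this is again tree-child. For a reticulation arc $f$ of $\mathcal{N}\backslash e$, $\mathcal{N}\backslash\{e,f\}$ denotes $(\mathcal{N}\backslash e)\backslash f$. -}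

module Defs where

open import Level using (0ℓ)
open import Data.Nat using (ℕ)
open import Data.Fin using (Fin)
open import Data.Product using (Σ; ∃; ∃-syntax; _×_; _,_; proj₁; proj₂)
open import Data.Sum using (_⊎_)
open import Data.Refinement using (Refinement; _,_; value)
open import Function.Bundles using (_↔_)
open import Relation.Nullary using (¬_)
open import Relation.Binary.PropositionalEquality using (_≡_; _≢_)

-- Directed graphs without parallel arcs: a vertex type and an arc relation
-- (E x y means "there is an arc (x , y)"; being a relation, there is at
-- most one arc from x to y).

record DiGraph : Set₁ where
  field
    V : Set
    E : V → V → Set

open DiGraph public

module _ (G : DiGraph) where

  -- in-/out-degree conditions (counting distinct neighbours)
  InDeg0 : V G → Set
  InDeg0 v = ∀ x → ¬ E G x v

  OutDeg0 : V G → Set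
  OutDeg0 v = ∀ y → ¬ E G v y

  InDeg1 : V G → Set
  InDeg1 v = Σ (V G) λ p → E G p v × (∀ x → E G x v → x ≡ p)

  OutDeg1 : V G → Set
  OutDeg1 v = Σ (V G) λ c → E G v c × (∀ y → E G v y → y ≡ c)

  InDeg2 : V G → Set
  InDeg2 v = Σ (V G) λ p → Σ (V G) λ q →
    p ≢ q × E G p v × E G q v × (∀ x → E G x v → x ≡ p ⊎ x ≡ q)

  OutDeg2 : V G → Set
  OutDeg2 v = Σ (V G) λ c → Σ (V G) λ d →
    c ≢ d × E G v c × E G v d × (∀ y → E G v y → y ≡ c ⊎ y ≡ d)

  data Path⁺ : V G → V G → Set where
    arc  : ∀ {x y} → E G x y → Path⁺ x y
    _∷_  : ∀ {x y z} → E G x y → Path⁺ y z → Path⁺ x z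

  Acyclic : Set
  Acyclic = ∀ x → ¬ Path⁺ x x

  Finite : Set
  Finite = Σ ℕ λ n → V G ↔ Fin n

  IsLeaf : V G → Set
  IsLeaf v = OutDeg0 v

  IsTreeVertex : V G → Set
  IsTreeVertex v = InDeg1 v × OutDeg2 v

  IsReticulation : V G → Set
  IsReticulation v = InDeg2 v × OutDeg1 v

  -- A (rooted binary) phylogenetic network on X, where X is its set of
  -- leaves (vertices of out-degree 0): finite, acyclic, a root of
  -- in-degree 0 and out-degree 2, every other vertex a leaf (in-degree 1,
  -- out-degree 0), a tree vertex or a reticulation; or, the one-vertex
  -- network (|X| = 1).
  IsNetwork : Set
  IsNetwork = Finite × Acyclic ×
    ( (Σ (V G) λ ρ → InDeg0 ρ × OutDeg2 ρ ×
         (∀ v → v ≢ ρ →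
            (InDeg1 v × OutDeg0 v) ⊎ IsTreeVertex v ⊎ IsReticulation v))
    ⊎ (Σ (V G) λ ρ → (∀ v → v ≡ ρ) × (∀ x y → ¬ E G x y)) )

  IsTreeChild : Set
  IsTreeChild = IsNetwork ×
    (∀ v → ¬ IsLeaf v → Σ (V G) λ c → E G v c × (IsTreeVertex c ⊎ IsLeaf c))

  IsReticulationArc : V G × V G → Set
  IsReticulationArc (u , v) = E G u v × IsReticulation v

  Adj : V G → V G → Set
  Adj x y = E G x y ⊎ E G y x

  IsThreeCycle : V G → V G → V G → Set
  IsThreeCycle a b c =
    a ≢ b × b ≢ c × a ≢ c × Adj a b × Adj b c × Adj a c

  HasThreeCycle : Set
  HasThreeCycle = ∃[ a ] ∃[ b ] ∃[ c ] IsThreeCycle a b c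

  -- an arc lies on the 3-cycle {a,b,c} if both its ends are among a,b,c
  OnTriple : V G → V G → V G → V G → Set
  OnTriple a b c x = x ≡ a ⊎ x ≡ b ⊎ x ≡ c

  HasThreeCycleWithRetArcs : V G × V G → V G × V G → Set
  HasThreeCycleWithRetArcs f f' =
    f ≢ f' × IsReticulationArc f × IsReticulationArc f' ×
    (∃[ a ] ∃[ b ] ∃[ c ] IsThreeCycle a b c ×
       OnTriple a b c (proj₁ f) × OnTriple a b c (proj₂ f) ×
       OnTriple a b c (proj₁ f') × OnTriple a b c (proj₂ f'))

-- Deleting a reticulation arc e = (u , v) and suppressing.
-- After deleting e, v has in-degree 1 and out-degree 1 and is suppressed;
-- u is either suppressed (u ≠ ρ) or deleted (u = ρ).  In both cases the
-- vertices u and v disappear, and the remaining arcs are the arcs of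
-- G - e between remaining vertices together with the arcs x → y obtained
-- by suppressing u or v (x → u → y or x → v → y in G - e).

_∖_ : (G : DiGraph) → V G × V G → DiGraph
G ∖ (u , v) = record
  { V = Refinement (V G) (λ x → x ≢ u × x ≢ v)
  ; E = λ x y → E₀ (value x) (value y)
              ⊎ (E₀ (value x) u × E₀ u (value y))
              ⊎ (E₀ (value x) v × E₀ v (value y))
  }
  where
  E₀ : V G → V G → Set
  E₀ a b = E G a b × ¬ (a ≡ u × b ≡ v)

{-# OPTIONS --safe #-}
-- Deleting a reticulation arc (u, v) of a tree-child network and suppressing u and v keeps it
-- tree-child: the parents and children of every remaining vertex correspond bijectively to the old
-- ones, u being replaced by its other child w or by its parent, and v by its child z or by its
-- other parent q. A new 3-cycle must use the arc p → w created by suppressing u (arcs created by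
-- suppressing v lie on no 3-cycle), together with old arcs w → k and p → k.
--
-- As N has no 3-cycles, the 3-cycle of N∖e is therefore such a triangle P → W → K, P → K; its
-- reticulation arcs are (P, K) and (W, K), and every 3-cycle of N∖e passes through both P and W.
-- Deleting (P, K) or (W, K) could thus only create a 3-cycle x → t → k, x → k with x → P → t
-- (resp. x → W → t), and the tree-child property of N∖e rules both configurations out.
module Submission where

open import Defs
open import Data.Product using (_×_; _,_)
open import Relation.Nullary using (¬_)
open import Data.Empty using (⊥; ⊥-elim; ⊥-elim-irr)
open import Data.Fin using (Fin; punchIn; punchOut)
open import Data.Fin.Induction using (spo-wellFounded)
open import Data.Fin.Properties
  using (¬Fin0; inj⇒≟; punchInᵢ≢i; punchOut-cong; punchIn-punchOut; punchOut-punchIn)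
open import Data.Irrelevant using ([_])
open import Data.Nat using (ℕ; zero; suc)
open import Data.Product using (Σ; proj₁; proj₂; map₂)
open import Data.Refinement using (Refinement; _,_; value; value-injective)
open import Data.Sum using (_⊎_; inj₁; inj₂; [_,_]′; swap) renaming (map to ⊎-map)
open import Function using (id; _∘_)
open import Function.Bundles using (_↔_; Inverse; Injection; mk↔ₛ′)
open import Function.Properties.Inverse using (↔-trans; ↔⇒↣)
open import Induction.WellFounded using (WellFounded; Acc; acc; module Subrelation)
open import Relation.Binary.Construct.On as On using ()
open import Relation.Binary.Definitions using (DecidableEquality)
open import Relation.Binary.PropositionalEquality
  using (_≡_; _≢_; refl; sym; trans; cong; subst; subst₂; ≢-sym; isEquivalence)
open import Relation.Binary.Structures using (IsStrictPartialOrder)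
open import Relation.Nullary using (yes; no)

-- InDeg1 G y and InDeg2 G y unfold to ExactlyOne and ExactlyTwo of (λ x → E G x y),
-- and similarly for out-degrees.
module _ {A : Set} (R : A → Set) where

  ExactlyOne : Set
  ExactlyOne = Σ A λ c → R c × (∀ a → R a → a ≡ c)

  ExactlyTwo : Set
  ExactlyTwo = Σ A λ c → Σ A λ d → c ≢ d × R c × R d × (∀ a → R a → a ≡ c ⊎ a ≡ d)

module _ {A : Set} {R : A → Set} where

  ExactlyOne-≡ : ExactlyOne R → ∀ {a b} → R a → R b → a ≡ b
  ExactlyOne-≡ (_ , _ , only) ra rb = trans (only _ ra) (sym (only _ rb))

  ExactlyTwo-third : ExactlyTwo R → ∀ {a b c} → R a → R b → R c → a ≢ b → c ≡ a ⊎ c ≡ b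
  ExactlyTwo-third (_ , _ , _ , _ , _ , only) ra rb rc a≢b
    with only _ ra | only _ rb | only _ rc
  ... | inj₁ refl | inj₁ refl | _         = ⊥-elim (a≢b refl)
  ... | inj₂ refl | inj₂ refl | _         = ⊥-elim (a≢b refl)
  ... | inj₁ refl | inj₂ refl | inj₁ refl = inj₁ refl
  ... | inj₁ refl | inj₂ refl | inj₂ refl = inj₂ refl
  ... | inj₂ refl | inj₁ refl | inj₁ refl = inj₂ refl
  ... | inj₂ refl | inj₁ refl | inj₂ refl = inj₁ refl

module NeighbourhoodTransfer {A B : Set} {R : A → Set} {S : B → Set} (φ : A → B)
  (φ-resp : ∀ a → R a → S (φ a))
  (φ-onto : ∀ b → S b → Σ A λ a → R a × φ a ≡ b)
  (φ-injective : ∀ a₁ a₂ → R a₁ → R a₂ → φ a₁ ≡ φ a₂ → a₁ ≡ a₂) where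

  none-transfer : (∀ a → ¬ R a) → ∀ b → ¬ S b
  none-transfer none b sb with φ-onto b sb
  ... | a , ra , _ = none a ra

  exactlyOne-transfer : ExactlyOne R → ExactlyOne S
  exactlyOne-transfer (c , rc , only) = φ c , φ-resp c rc , only′
    where
    only′ : ∀ b → S b → b ≡ φ c
    only′ b sb with φ-onto b sb
    ... | a , ra , refl = cong φ (only a ra)

  exactlyTwo-transfer : ExactlyTwo R → ExactlyTwo S
  exactlyTwo-transfer (c , d , c≢d , rc , rd , only) =
    φ c , φ d , (λ eq → c≢d (φ-injective c d rc rd eq)) , φ-resp c rc , φ-resp d rd , only′
    where
    only′ : ∀ b → S b → b ≡ φ c ⊎ b ≡ φ d
    only′ b sb with φ-onto b sb
    ... | a , ra , refl = ⊎-map (cong φ) (cong φ) (only a ra)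

IsFinite : Set → Set
IsFinite A = Σ ℕ λ n → A ↔ Fin n

IsFinite-≟ : ∀ {A} → IsFinite A → DecidableEquality A
IsFinite-≟ (_ , A↔Fin) = inj⇒≟ (↔⇒↣ A↔Fin)

IsFinite-remove : ∀ {A} → IsFinite A → (a : A) → IsFinite (Refinement A (_≢ a))
IsFinite-remove (zero , A↔Fin) a = ⊥-elim (¬Fin0 (Inverse.to A↔Fin a))
IsFinite-remove {A} (suc n , A↔Fin) a = n , mk↔ₛ′ to from to∘from from∘to
  where
  open Inverse A↔Fin using (strictlyInverseˡ; strictlyInverseʳ) renaming (to to ι; from to ι⁻¹)

  ι-a≢ : (x : Refinement A (_≢ a)) → ι a ≢ ι (value x)
  ι-a≢ (x , [ x≢a ]) ιa≡ιx = ⊥-elim-irr (x≢a (ι-injective (sym ιa≡ιx)))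
    where
    ι-injective : ∀ {x y} → ι x ≡ ι y → x ≡ y
    ι-injective = Injection.injective (↔⇒↣ A↔Fin)

  to : Refinement A (_≢ a) → Fin n
  to x = punchOut (ι-a≢ x)

  from : Fin n → Refinement A (_≢ a)
  from i = ι⁻¹ (punchIn (ι a) i) ,
           [ (λ eq → punchInᵢ≢i (ι a) i (trans (sym (strictlyInverseˡ _)) (cong ι eq))) ]

  to∘from : ∀ i → to (from i) ≡ i
  to∘from i = trans (punchOut-cong (ι a) (strictlyInverseˡ _)) (punchOut-punchIn (ι a))

  from∘to : ∀ x → from (to x) ≡ x
  from∘to x = value-injective
    (trans (cong ι⁻¹ (punchIn-punchOut (ι-a≢ x))) (strictlyInverseʳ (value x)))

IsFinite-remove₂ : ∀ {A} → IsFinite A → (u v : A) → v ≢ u →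
  IsFinite (Refinement A (λ x → x ≢ u × x ≢ v))
IsFinite-remove₂ {A} finite u v v≢u =
  map₂ (↔-trans nest) (IsFinite-remove (IsFinite-remove finite u) v′)
  where
  A∖u A∖uv A∖u∖v : Set
  A∖u = Refinement A (_≢ u)
  A∖uv = Refinement A (λ x → x ≢ u × x ≢ v)
  v′ : A∖u
  v′ = v , [ v≢u ]
  A∖u∖v = Refinement A∖u (_≢ v′)

  nest : A∖uv ↔ A∖u∖v
  nest = mk↔ₛ′ to from (λ _ → refl) (λ _ → refl)
    where
    to : A∖uv → A∖u∖v
    to (x , [ x∉uv ]) = (x , [ proj₁ x∉uv ]) , [ (λ eq → proj₂ x∉uv (cong value eq)) ]
    from : A∖u∖v → A∖uv
    from ((x , [ x≢u ]) , [ x≢v ]) = x , [ (x≢u , λ eq → x≢v (value-injective eq)) ]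

TreeOrLeaf : (G : DiGraph) → V G → Set
TreeOrLeaf G y = IsTreeVertex G y ⊎ IsLeaf G y

NonRootKind : (G : DiGraph) → V G → Set
NonRootKind G y = (InDeg1 G y × OutDeg0 G y) ⊎ IsTreeVertex G y ⊎ IsReticulation G y

ThreeCyclesThrough : (G : DiGraph) → V G → Set
ThreeCyclesThrough G x = ∀ a b c → IsThreeCycle G a b c → OnTriple G a b c x

Rooted : DiGraph → Set
Rooted G = Σ (V G) λ ρ → InDeg0 G ρ × OutDeg2 G ρ × (∀ y → y ≢ ρ → NonRootKind G y)

_++ᵖ_ : ∀ {G : DiGraph} {x y z} → Path⁺ G x y → Path⁺ G y z → Path⁺ G x z
arc e ++ᵖ q = e ∷ q
(e ∷ p) ++ᵖ q = e ∷ (p ++ᵖ q)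

Path⁺-head : ∀ {G : DiGraph} {x y} → Path⁺ G x y → Σ (V G) λ m → E G x m
Path⁺-head (arc e) = _ , e
Path⁺-head (e ∷ _) = _ , e

Path⁺-wellFounded : (G : DiGraph) → Finite G → Acyclic G → WellFounded (Path⁺ G)
Path⁺-wellFounded G (n , V↔Fin) acyclic =
  Subrelation.wellFounded reindex (On.wellFounded ι (spo-wellFounded spo))
  where
  open Inverse V↔Fin using (strictlyInverseʳ) renaming (to to ι; from to ι⁻¹)

  _⊏_ : Fin n → Fin n → Set
  i ⊏ j = Path⁺ G (ι⁻¹ i) (ι⁻¹ j)

  spo : IsStrictPartialOrder _≡_ _⊏_
  spo = record
    { isEquivalence = isEquivalence
    ; irrefl = λ { refl p → acyclic _ p }
    ; trans = _++ᵖ_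
    ; <-resp-≈ = (λ { refl p → p }) , (λ { refl p → p })
    }

  reindex : ∀ {x y} → Path⁺ G x y → ι x ⊏ ι y
  reindex {x} {y} = subst₂ (Path⁺ G) (sym (strictlyInverseʳ x)) (sym (strictlyInverseʳ y))

module Triples (G : DiGraph) where

  TripleSubset : (a b c p q r : V G) → Set
  TripleSubset a b c p q r = OnTriple G p q r a × OnTriple G p q r b × OnTriple G p q r c

  SameTriple : (a b c p q r : V G) → Set
  SameTriple a b c p q r = TripleSubset a b c p q r × TripleSubset p q r a b c

  module _ {a b c : V G} where

    on₁ : OnTriple G a b c a
    on₁ = inj₁ refl

    on₂ : OnTriple G a b c b
    on₂ = inj₂ (inj₁ refl)

    on₃ : OnTriple G a b c c
    on₃ = inj₂ (inj₂ refl)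

  module _ {a b c : V G} where

    SameTriple-refl : SameTriple a b c a b c
    SameTriple-refl = (on₁ , on₂ , on₃) , (on₁ , on₂ , on₃)

    SameTriple-swap₁₂ : SameTriple a b c b a c
    SameTriple-swap₁₂ = (on₂ , on₁ , on₃) , (on₂ , on₁ , on₃)

    SameTriple-swap₂₃ : SameTriple a b c a c b
    SameTriple-swap₂₃ = (on₁ , on₃ , on₂) , (on₁ , on₃ , on₂)

    SameTriple-rotate : SameTriple a b c b c a
    SameTriple-rotate = (on₃ , on₁ , on₂) , (on₂ , on₃ , on₁)

    IsThreeCycle-swap₂₃ : IsThreeCycle G a b c → IsThreeCycle G a c b
    IsThreeCycle-swap₂₃ (a≢b , b≢c , a≢c , ab , bc , ac) =
      a≢c , ≢-sym b≢c , a≢b , ac , swap bc , ab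

    IsThreeCycle-rotate : IsThreeCycle G a b c → IsThreeCycle G b c a
    IsThreeCycle-rotate (a≢b , b≢c , a≢c , ab , bc , ac) =
      b≢c , ≢-sym a≢c , ≢-sym a≢b , bc , swap ac , swap ab

  TripleSubset-OnTriple : ∀ {a b c p q r x} → TripleSubset a b c p q r →
    OnTriple G a b c x → OnTriple G p q r x
  TripleSubset-OnTriple (a-on , _ , _) (inj₁ refl) = a-on
  TripleSubset-OnTriple (_ , b-on , _) (inj₂ (inj₁ refl)) = b-on
  TripleSubset-OnTriple (_ , _ , c-on) (inj₂ (inj₂ refl)) = c-on

  TripleSubset-trans : ∀ {a b c p q r x y z} → TripleSubset a b c p q r →
    TripleSubset p q r x y z → TripleSubset a b c x y z
  TripleSubset-trans (a-on , b-on , c-on) sub =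
    TripleSubset-OnTriple sub a-on , TripleSubset-OnTriple sub b-on , TripleSubset-OnTriple sub c-on

  SameTriple-trans : ∀ {a b c p q r x y z} → SameTriple a b c p q r →
    SameTriple p q r x y z → SameTriple a b c x y z
  SameTriple-trans (sub₁ , sup₁) (sub₂ , sup₂) =
    TripleSubset-trans sub₁ sub₂ , TripleSubset-trans sup₂ sup₁

-- The arc a₀ → b₀ rules out the one-vertex network, so G has a root.
module TreeChild (G : DiGraph) (tc : IsTreeChild G) {a₀ b₀ : V G} (a₀→b₀ : E G a₀ b₀) where

  finite : Finite G
  finite = proj₁ (proj₁ tc)

  acyclic : Acyclic G
  acyclic = proj₁ (proj₂ (proj₁ tc))

  tree-child : ∀ x → ¬ IsLeaf G x → Σ (V G) λ c → E G x c × TreeOrLeaf G c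
  tree-child = proj₂ tc

  rooted : Rooted G
  rooted with proj₂ (proj₂ (proj₁ tc))
  ... | inj₁ r = r
  ... | inj₂ (_ , _ , no-arc) = ⊥-elim (no-arc a₀ b₀ a₀→b₀)

  ρ : V G
  ρ = proj₁ rooted

  ρ-InDeg0 : InDeg0 G ρ
  ρ-InDeg0 = proj₁ (proj₂ rooted)

  ρ-OutDeg2 : OutDeg2 G ρ
  ρ-OutDeg2 = proj₁ (proj₂ (proj₂ rooted))

  kind : ∀ x → x ≢ ρ → NonRootKind G x
  kind = proj₂ (proj₂ (proj₂ rooted))

  _≟_ : DecidableEquality (V G)
  _≟_ = IsFinite-≟ finite

  no-loop : ∀ {x} → ¬ E G x x
  no-loop x→x = acyclic _ (arc x→x)

  no-2-cycle : ∀ {x y} → E G x y → ¬ E G y x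
  no-2-cycle x→y y→x = acyclic _ (x→y ∷ arc y→x)

  no-3-cycle : ∀ {x y z} → E G x y → E G y z → ¬ E G z x
  no-3-cycle x→y y→z z→x = acyclic _ (x→y ∷ (y→z ∷ arc z→x))

  arc⇒≢ : ∀ {x y} → E G x y → x ≢ y
  arc⇒≢ x→y refl = no-loop x→y

  arc-target≢ρ : ∀ {x y} → E G x y → y ≢ ρ
  arc-target≢ρ x→y refl = ρ-InDeg0 _ x→y

  parent-exists : ∀ {x} → x ≢ ρ → Σ (V G) λ p → E G p x
  parent-exists {x} x≢ρ with kind x x≢ρ
  ... | inj₁ ((p , p→x , _) , _) = p , p→x
  ... | inj₂ (inj₁ ((p , p→x , _) , _)) = p , p→x
  ... | inj₂ (inj₂ ((p , _ , _ , p→x , _) , _)) = p , p→x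

  reachable-from-ρ : ∀ x → x ≡ ρ ⊎ Path⁺ G ρ x
  reachable-from-ρ x = reach (Path⁺-wellFounded G finite acyclic x)
    where
    reach : ∀ {x} → Acc (Path⁺ G) x → x ≡ ρ ⊎ Path⁺ G ρ x
    reach {x} (acc smaller) with x ≟ ρ
    ... | yes x≡ρ = inj₁ x≡ρ
    ... | no x≢ρ with parent-exists x≢ρ
    ...   | p , p→x with reach (smaller (arc p→x))
    ...     | inj₁ refl = inj₂ (arc p→x)
    ...     | inj₂ ρ⇝p = inj₂ (ρ⇝p ++ᵖ arc p→x)

  children-third : ∀ {x a b c} → E G x a → E G x b → E G x c → a ≢ b → c ≡ a ⊎ c ≡ b
  children-third {x} x→a x→b x→c a≢b with x ≟ ρ
  ... | yes refl = ExactlyTwo-third ρ-OutDeg2 x→a x→b x→c a≢b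
  ... | no x≢ρ with kind x x≢ρ
  ...   | inj₁ (_ , leaf) = ⊥-elim (leaf _ x→a)
  ...   | inj₂ (inj₁ (_ , out₂)) = ExactlyTwo-third out₂ x→a x→b x→c a≢b
  ...   | inj₂ (inj₂ (_ , out₁)) = ⊥-elim (a≢b (ExactlyOne-≡ out₁ x→a x→b))

  two-parents⇒reticulation : ∀ {y a b} → E G a y → E G b y → a ≢ b → IsReticulation G y
  two-parents⇒reticulation {y} a→y b→y a≢b with kind y (arc-target≢ρ a→y)
  ... | inj₁ (in₁ , _) = ⊥-elim (a≢b (ExactlyOne-≡ in₁ a→y b→y))
  ... | inj₂ (inj₁ (in₁ , _)) = ⊥-elim (a≢b (ExactlyOne-≡ in₁ a→y b→y))
  ... | inj₂ (inj₂ y-ret) = y-ret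

  parents-third : ∀ {y a b c} → E G a y → E G b y → E G c y → a ≢ b → c ≡ a ⊎ c ≡ b
  parents-third a→y b→y c→y a≢b =
    ExactlyTwo-third (proj₁ (two-parents⇒reticulation a→y b→y a≢b)) a→y b→y c→y a≢b

  two-parents⇒one-child : ∀ {y a b c d} → E G a y → E G b y → a ≢ b → E G y c → E G y d → c ≡ d
  two-parents⇒one-child a→y b→y a≢b = ExactlyOne-≡ (proj₂ (two-parents⇒reticulation a→y b→y a≢b))

  two-parents⇒¬TreeOrLeaf : ∀ {y a b} → E G a y → E G b y → a ≢ b → ¬ TreeOrLeaf G y
  two-parents⇒¬TreeOrLeaf a→y b→y a≢b (inj₁ (in₁ , _)) = a≢b (ExactlyOne-≡ in₁ a→y b→y)
  two-parents⇒¬TreeOrLeaf a→y b→y a≢b (inj₂ leaf) with two-parents⇒reticulation a→y b→y a≢b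
  ... | _ , (c , y→c , _) = leaf c y→c

  reticulation⇒¬TreeOrLeaf : ∀ {y} → IsReticulation G y → ¬ TreeOrLeaf G y
  reticulation⇒¬TreeOrLeaf ((p , q , p≢q , p→y , q→y , _) , _) =
    two-parents⇒¬TreeOrLeaf p→y q→y p≢q

  TreeOrLeaf-child : ∀ {x a b} → E G x a → E G x b → a ≢ b → TreeOrLeaf G a ⊎ TreeOrLeaf G b
  TreeOrLeaf-child {x} x→a x→b a≢b with tree-child x (λ leaf → leaf _ x→a)
  ... | c , x→c , c-tl with children-third x→a x→b x→c a≢b
  ...   | inj₁ refl = inj₁ c-tl
  ...   | inj₂ refl = inj₂ c-tl

  reticulation-child-TreeOrLeaf : ∀ {x y} → IsReticulation G x → E G x y → TreeOrLeaf G y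
  reticulation-child-TreeOrLeaf {x} (_ , out₁) x→y with tree-child x (λ leaf → leaf _ x→y)
  ... | c , x→c , c-tl = subst (TreeOrLeaf G) (ExactlyOne-≡ out₁ x→c x→y) c-tl

  reticulation-sibling-TreeOrLeaf : ∀ {x r y} → IsReticulation G r → E G x r → E G x y → y ≢ r →
    TreeOrLeaf G y
  reticulation-sibling-TreeOrLeaf r-ret x→r x→y y≢r =
    [ ⊥-elim ∘ reticulation⇒¬TreeOrLeaf r-ret , id ]′ (TreeOrLeaf-child x→r x→y (≢-sym y≢r))

module ArcDeletion (G : DiGraph) (tc : IsTreeChild G) {u v : V G}
                   (u→v : E G u v) (v-ret : IsReticulation G v) where
  open TreeChild G tc u→v public

  G' : DiGraph
  G' = G ∖ (u , v)

  V' : Set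
  V' = V G'

  open Triples G'

  vertex : (x : V G) → x ≢ u → x ≢ v → V'
  vertex x x≢u x≢v = x , [ (x≢u , x≢v) ]

  value≢u : (x : V') → value x ≢ u
  value≢u (_ , [ x∉uv ]) eq = ⊥-elim-irr (proj₁ x∉uv eq)

  value≢v : (x : V') → value x ≢ v
  value≢v (_ , [ x∉uv ]) eq = ⊥-elim-irr (proj₂ x∉uv eq)

  value-≢ : ∀ {x y : V'} → x ≢ y → value x ≢ value y
  value-≢ x≢y eq = x≢y (value-injective eq)

  u≢v : u ≢ v
  u≢v = arc⇒≢ u→v

  private
    other-parent : InDeg2 G v → Σ (V G) λ q → E G q v × q ≢ u
    other-parent (p , p′ , p≢p′ , p→v , p′→v , _) with p ≟ u
    ... | yes refl = p′ , p′→v , ≢-sym p≢p′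
    ... | no p≢u = p , p→v , p≢u

    other-child : OutDeg2 G u → Σ (V G) λ w → E G u w × w ≢ v
    other-child (c , d , c≢d , u→c , u→d , _) with c ≟ v
    ... | yes refl = d , u→d , ≢-sym c≢d
    ... | no c≢v = c , u→c , c≢v

  q : V G
  q = proj₁ (other-parent (proj₁ v-ret))

  q→v : E G q v
  q→v = proj₁ (proj₂ (other-parent (proj₁ v-ret)))

  q≢u : q ≢ u
  q≢u = proj₂ (proj₂ (other-parent (proj₁ v-ret)))

  z : V G
  z = proj₁ (proj₂ v-ret)

  v→z : E G v z
  v→z = proj₁ (proj₂ (proj₂ v-ret))

  v-child≡z : ∀ {y} → E G v y → y ≡ z
  v-child≡z = proj₂ (proj₂ (proj₂ v-ret)) _

  u-OutDeg2 : OutDeg2 G u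
  u-OutDeg2 with u ≟ ρ
  ... | yes u≡ρ = subst (OutDeg2 G) (sym u≡ρ) ρ-OutDeg2
  ... | no u≢ρ with kind u u≢ρ
  ...   | inj₁ (_ , leaf) = ⊥-elim (leaf v u→v)
  ...   | inj₂ (inj₁ (_ , out₂)) = out₂
  ...   | inj₂ (inj₂ u-ret) =
          ⊥-elim (reticulation⇒¬TreeOrLeaf v-ret (reticulation-child-TreeOrLeaf u-ret u→v))

  w : V G
  w = proj₁ (other-child u-OutDeg2)

  u→w : E G u w
  u→w = proj₁ (proj₂ (other-child u-OutDeg2))

  w≢v : w ≢ v
  w≢v = proj₂ (proj₂ (other-child u-OutDeg2))

  w-TreeOrLeaf : TreeOrLeaf G w
  w-TreeOrLeaf = reticulation-sibling-TreeOrLeaf v-ret u→v u→w w≢v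

  u-children : ∀ {y} → E G u y → y ≡ v ⊎ y ≡ w
  u-children u→y = children-third u→v u→w u→y (≢-sym w≢v)

  v-parents : ∀ {a} → E G a v → a ≡ u ⊎ a ≡ q
  v-parents a→v = parents-third u→v q→v a→v (≢-sym q≢u)

  w-sole-parent : ∀ {a} → E G a w → a ≡ u
  w-sole-parent {a} a→w with a ≟ u
  ... | yes a≡u = a≡u
  ... | no a≢u = ⊥-elim (two-parents⇒¬TreeOrLeaf a→w u→w a≢u w-TreeOrLeaf)

  z-sole-parent : ∀ {a} → E G a z → a ≡ v
  z-sole-parent {a} a→z with a ≟ v
  ... | yes a≡v = a≡v
  ... | no a≢v =
        ⊥-elim (two-parents⇒¬TreeOrLeaf a→z v→z a≢v (reticulation-child-TreeOrLeaf v-ret v→z))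

  v-child-sole-parent : ∀ {a t} → E G v t → E G a t → a ≡ v
  v-child-sole-parent v→t a→t = z-sole-parent (subst (E G _) (v-child≡z v→t) a→t)

  u-parent-unique : ∀ {a b} → E G a u → E G b u → a ≡ b
  u-parent-unique {a} {b} a→u b→u with a ≟ b
  ... | yes a≡b = a≡b
  ... | no a≢b = ⊥-elim (w≢v (two-parents⇒one-child a→u b→u a≢b u→w u→v))

  w≢u : w ≢ u
  w≢u = ≢-sym (arc⇒≢ u→w)

  z≢u : z ≢ u
  z≢u z≡u = no-2-cycle u→v (subst (E G v) z≡u v→z)

  z≢v : z ≢ v
  z≢v = ≢-sym (arc⇒≢ v→z)

  q≢v : q ≢ v
  q≢v = arc⇒≢ q→v

  w' z' q' : V'
  w' = vertex w w≢u w≢v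
  z' = vertex z z≢u z≢v
  q' = vertex q q≢u q≢v

  u-child≡w : (y : V') → E G u (value y) → value y ≡ w
  u-child≡w y u→y = [ (λ y≡v → ⊥-elim (value≢v y y≡v)) , id ]′ (u-children u→y)

  v-parent≡q : (x : V') → E G (value x) v → value x ≡ q
  v-parent≡q x x→v = [ (λ x≡u → ⊥-elim (value≢u x x≡u)) , id ]′ (v-parents x→v)

  data ArcView (x y : V') : Set where
    old   : E G (value x) (value y) → ArcView x y
    via-u : E G (value x) u → E G u (value y) → ArcView x y
    via-v : E G (value x) v → E G v (value y) → ArcView x y

  view : ∀ x y → E G' x y → ArcView x y
  view _ _ (inj₁ (x→y , _)) = old x→y
  view _ _ (inj₂ (inj₁ ((x→u , _) , (u→y , _)))) = via-u x→u u→y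
  view _ _ (inj₂ (inj₂ ((x→v , _) , (v→y , _)))) = via-v x→v v→y

  old-arc : ∀ x y → E G (value x) (value y) → E G' x y
  old-arc x y x→y = inj₁ (x→y , λ eqs → value≢u x (proj₁ eqs))

  via-u-arc : ∀ x y → E G (value x) u → E G u (value y) → E G' x y
  via-u-arc x y x→u u→y =
    inj₂ (inj₁ ((x→u , λ eqs → value≢u x (proj₁ eqs)) , (u→y , λ eqs → value≢v y (proj₂ eqs))))

  via-v-arc : ∀ x y → E G (value x) v → E G v (value y) → E G' x y
  via-v-arc x y x→v v→y =
    inj₂ (inj₂ ((x→v , λ eqs → value≢u x (proj₁ eqs)) , (v→y , λ eqs → u≢v (sym (proj₁ eqs)))))

  arc-lift : ∀ x y → E G' x y → Path⁺ G (value x) (value y)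
  arc-lift x y x→y with view x y x→y
  ... | old x→y′ = arc x→y′
  ... | via-u x→u u→y = x→u ∷ arc u→y
  ... | via-v x→v v→y = x→v ∷ arc v→y

  path-lift : ∀ {x y} → Path⁺ G' x y → Path⁺ G (value x) (value y)
  path-lift {x} {y} (arc x→y) = arc-lift x y x→y
  path-lift {x} (_∷_ {y = m} x→m m⇝y) = arc-lift x m x→m ++ᵖ path-lift m⇝y

  ∖-Acyclic : Acyclic G'
  ∖-Acyclic x x⇝x = acyclic (value x) (path-lift x⇝x)

  no-3-cycle' : (x y t : V') → E G' x y → E G' y t → ¬ E G' t x
  no-3-cycle' x y t x→y y→t t→x =
    ∖-Acyclic x (_∷_ {x = x} {y = y} x→y (_∷_ {x = y} {y = t} y→t (arc {x = t} {y = x} t→x)))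

  SoleParent : V G → V G → Set
  SoleParent a t = ∀ {b} → E G b t → b ≡ a

  -- Suppressing u turns an arc x → u into x → w, suppressing v turns x → v into x → z.
  child : V G → V'
  child y with y ≟ u | y ≟ v
  ... | yes _ | _ = w'
  ... | no _ | yes _ = z'
  ... | no y≢u | no y≢v = vertex y y≢u y≢v

  child-value : (y : V') → child (value y) ≡ y
  child-value y with value y ≟ u | value y ≟ v
  ... | yes y≡u | _ = ⊥-elim (value≢u y y≡u)
  ... | no _ | yes y≡v = ⊥-elim (value≢v y y≡v)
  ... | no _ | no _ = refl

  child-u : child u ≡ w'
  child-u with u ≟ u
  ... | yes _ = refl
  ... | no u≢u = ⊥-elim (u≢u refl)

  child-v : child v ≡ z'
  child-v with v ≟ u | v ≟ v
  ... | yes v≡u | _ = ⊥-elim (u≢v (sym v≡u))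
  ... | no _ | yes _ = refl
  ... | no _ | no v≢v = ⊥-elim (v≢v refl)

  child-cases : ∀ y →
    value (child y) ≡ y ⊎ (E G y (value (child y)) × SoleParent y (value (child y)))
  child-cases y with y ≟ u | y ≟ v
  ... | yes refl | _ = inj₂ (u→w , w-sole-parent)
  ... | no _ | yes refl = inj₂ (v→z , z-sole-parent)
  ... | no _ | no _ = inj₁ refl

  child-arc : (x : V') → ∀ y → E G (value x) y → E G' x (child y)
  child-arc x y x→y with y ≟ u | y ≟ v
  ... | yes refl | _ = via-u-arc x w' x→y u→w
  ... | no _ | yes refl = via-v-arc x z' x→y v→z
  ... | no y≢u | no y≢v = old-arc x (vertex y y≢u y≢v) x→y

  child-onto : (x : V') → ∀ b → E G' x b → Σ (V G) λ y → E G (value x) y × child y ≡ b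
  child-onto x b x→b with view x b x→b
  ... | old x→b′ = value b , x→b′ , child-value b
  ... | via-u x→u u→b = u , x→u , trans child-u (value-injective (sym (u-child≡w b u→b)))
  ... | via-v x→v v→b = v , x→v , trans child-v (value-injective (sym (v-child≡z v→b)))

  kept-child≢replaced-child : (x : V') → ∀ {y y′} → E G (value x) y → E G (value x) y′ →
    value (child y) ≡ y → SoleParent y′ (value (child y′)) → child y ≢ child y′
  kept-child≢replaced-child x {y′ = y′} x→y x→y′ kept sole eq =
    no-loop (subst (E G (value x)) (sym x≡y′) x→y′)
    where
    x≡y′ : value x ≡ y′
    x≡y′ = sole (subst (E G (value x)) (trans (sym kept) (cong value eq)) x→y)

  child-injective : (x : V') → ∀ y₁ y₂ → E G (value x) y₁ → E G (value x) y₂ →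
    child y₁ ≡ child y₂ → y₁ ≡ y₂
  child-injective x y₁ y₂ x→y₁ x→y₂ eq with child-cases y₁ | child-cases y₂
  ... | inj₁ kept₁ | inj₁ kept₂ = trans (sym kept₁) (trans (cong value eq) kept₂)
  ... | inj₁ kept₁ | inj₂ (_ , sole₂) =
        ⊥-elim (kept-child≢replaced-child x x→y₁ x→y₂ kept₁ sole₂ eq)
  ... | inj₂ (_ , sole₁) | inj₁ kept₂ =
        ⊥-elim (kept-child≢replaced-child x x→y₂ x→y₁ kept₂ sole₁ (sym eq))
  ... | inj₂ (_ , sole₁) | inj₂ (y₂→t , _) =
        sym (sole₁ (subst (E G y₂) (cong value (sym eq)) y₂→t))

  module Children (x : V') =
    NeighbourhoodTransfer child (child-arc x) (child-onto x) (child-injective x)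

  -- pᵤ stands for the parent of u, needed only when u is a parent of y.
  module Neighbourhood (y pᵤ : V') (pᵤ→u : E G u (value y) → E G (value pᵤ) u) where

    parent : V G → V'
    parent a with a ≟ u | a ≟ v
    ... | yes _ | _ = pᵤ
    ... | no _ | yes _ = q'
    ... | no a≢u | no a≢v = vertex a a≢u a≢v

    parent-value : (b : V') → parent (value b) ≡ b
    parent-value b with value b ≟ u | value b ≟ v
    ... | yes b≡u | _ = ⊥-elim (value≢u b b≡u)
    ... | no _ | yes b≡v = ⊥-elim (value≢v b b≡v)
    ... | no _ | no _ = refl

    parent-u : parent u ≡ pᵤ
    parent-u with u ≟ u
    ... | yes _ = refl
    ... | no u≢u = ⊥-elim (u≢u refl)

    parent-v : parent v ≡ q'
    parent-v with v ≟ u | v ≟ v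
    ... | yes v≡u | _ = ⊥-elim (u≢v (sym v≡u))
    ... | no _ | yes _ = refl
    ... | no _ | no v≢v = ⊥-elim (v≢v refl)

    parent-cases : ∀ a → E G a (value y) → value (parent a) ≡ a ⊎ SoleParent a (value y)
    parent-cases a a→y with a ≟ u | a ≟ v
    ... | yes refl | _ = inj₂ (λ b→y → w-sole-parent (subst (E G _) (u-child≡w y a→y) b→y))
    ... | no _ | yes refl = inj₂ (v-child-sole-parent a→y)
    ... | no _ | no _ = inj₁ refl

    parent-arc : ∀ a → E G a (value y) → E G' (parent a) y
    parent-arc a a→y with a ≟ u | a ≟ v
    ... | yes refl | _ = via-u-arc pᵤ y (pᵤ→u a→y) a→y
    ... | no _ | yes refl = via-v-arc q' y q→v a→y
    ... | no a≢u | no a≢v = old-arc (vertex a a≢u a≢v) y a→y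

    parent-onto : ∀ b → E G' b y → Σ (V G) λ a → E G a (value y) × parent a ≡ b
    parent-onto b b→y with view b y b→y
    ... | old b→y′ = value b , b→y′ , parent-value b
    ... | via-u b→u u→y =
          u , u→y , trans parent-u (value-injective (u-parent-unique (pᵤ→u u→y) b→u))
    ... | via-v b→v v→y = v , v→y , trans parent-v (value-injective (sym (v-parent≡q b b→v)))

    parent-injective : ∀ a₁ a₂ → E G a₁ (value y) → E G a₂ (value y) →
      parent a₁ ≡ parent a₂ → a₁ ≡ a₂
    parent-injective a₁ a₂ a₁→y a₂→y eq with parent-cases a₁ a₁→y | parent-cases a₂ a₂→y
    ... | inj₂ sole₁ | _ = sym (sole₁ a₂→y)
    ... | inj₁ _ | inj₂ sole₂ = sole₂ a₁→y
    ... | inj₁ kept₁ | inj₁ kept₂ = trans (sym kept₁) (trans (cong value eq) kept₂)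

    module Parents = NeighbourhoodTransfer parent parent-arc parent-onto parent-injective
    module Children-y = Children y

    NonRootKind-transfer : NonRootKind G (value y) → NonRootKind G' y
    NonRootKind-transfer (inj₁ (in₁ , out₀)) =
      inj₁ (Parents.exactlyOne-transfer in₁ , Children-y.none-transfer out₀)
    NonRootKind-transfer (inj₂ (inj₁ (in₁ , out₂))) =
      inj₂ (inj₁ (Parents.exactlyOne-transfer in₁ , Children-y.exactlyTwo-transfer out₂))
    NonRootKind-transfer (inj₂ (inj₂ (in₂ , out₁))) =
      inj₂ (inj₂ (Parents.exactlyTwo-transfer in₂ , Children-y.exactlyOne-transfer out₁))

    TreeOrLeaf-transfer : TreeOrLeaf G (value y) → TreeOrLeaf G' y
    TreeOrLeaf-transfer (inj₁ (in₁ , out₂)) =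
      inj₁ (Parents.exactlyOne-transfer in₁ , Children-y.exactlyTwo-transfer out₂)
    TreeOrLeaf-transfer (inj₂ out₀) = inj₂ (Children-y.none-transfer out₀)

  w-leaf⇒¬u⇝q : IsLeaf G w → ¬ Path⁺ G u q
  w-leaf⇒¬u⇝q w-leaf (arc u→q) with u-children u→q
  ... | inj₁ q≡v = q≢v q≡v
  ... | inj₂ q≡w = w-leaf v (subst (λ a → E G a v) q≡w q→v)
  w-leaf⇒¬u⇝q w-leaf (u→y ∷ y⇝q) with u-children u→y
  ... | inj₁ refl = acyclic v (y⇝q ++ᵖ arc q→v)
  ... | inj₂ refl = w-leaf _ (proj₂ (Path⁺-head y⇝q))

  -- If w were a leaf, the other parent q of v could not be reached from the root u.
  u≡ρ⇒w-IsTreeVertex : u ≡ ρ → IsTreeVertex G w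
  u≡ρ⇒w-IsTreeVertex u≡ρ with w-TreeOrLeaf
  ... | inj₁ w-tree = w-tree
  ... | inj₂ w-leaf with reachable-from-ρ q
  ...   | inj₁ q≡ρ = ⊥-elim (q≢u (trans q≡ρ (sym u≡ρ)))
  ...   | inj₂ ρ⇝q = ⊥-elim (w-leaf⇒¬u⇝q w-leaf (subst (λ a → Path⁺ G a q) (sym u≡ρ) ρ⇝q))

  ∖-Rooted-at-ρ : u ≢ ρ → ∀ {p} → E G p u → Rooted G'
  ∖-Rooted-at-ρ u≢ρ {p} p→u =
    ρ' , Neighbourhood.Parents.none-transfer ρ' p' (λ _ → p→u) ρ-InDeg0 ,
    Children.exactlyTwo-transfer ρ' ρ-OutDeg2 ,
    λ y y≢ρ' →
      Neighbourhood.NonRootKind-transfer y p' (λ _ → p→u) (kind (value y) (value-≢ y≢ρ'))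
    where
    ρ' p' : V'
    ρ' = vertex ρ (≢-sym u≢ρ) (≢-sym (arc-target≢ρ u→v))
    p' = vertex p (arc⇒≢ p→u) (λ p≡v → no-2-cycle u→v (subst (λ a → E G a u) p≡v p→u))

  -- w becomes the root; the dummy choice pᵤ = y is harmless, as u is a parent of no y ≢ w'.
  ∖-Rooted-at-w : u ≡ ρ → Rooted G'
  ∖-Rooted-at-w u≡ρ =
    w' , w'-InDeg0 , Children.exactlyTwo-transfer w' (proj₂ (u≡ρ⇒w-IsTreeVertex u≡ρ)) ,
    λ y y≢w' → Neighbourhood.NonRootKind-transfer y y (¬u→y y y≢w')
                 (kind (value y) (λ y≡ρ → value≢u y (trans y≡ρ (sym u≡ρ))))
    where
    w'-InDeg0 : InDeg0 G' w'
    w'-InDeg0 x x→w with view x w' x→w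
    ... | old x→w′ = value≢u x (w-sole-parent x→w′)
    ... | via-u x→u _ = ρ-InDeg0 _ (subst (E G (value x)) u≡ρ x→u)
    ... | via-v _ v→w = u≢v (sym (w-sole-parent v→w))

    ¬u→y : (y : V') → y ≢ w' → E G u (value y) → E G (value y) u
    ¬u→y y y≢w' u→y = ⊥-elim (y≢w' (value-injective (u-child≡w y u→y)))

  ∖-Rooted : Rooted G'
  ∖-Rooted with u ≟ ρ
  ... | yes u≡ρ = ∖-Rooted-at-w u≡ρ
  ... | no u≢ρ = ∖-Rooted-at-ρ u≢ρ (proj₂ (parent-exists u≢ρ))

  ∖-IsNetwork : IsNetwork G'
  ∖-IsNetwork = IsFinite-remove₂ finite u v (≢-sym u≢v) , ∖-Acyclic , inj₁ ∖-Rooted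

  child-TreeOrLeaf : (x : V') → ∀ {c} → E G (value x) c → TreeOrLeaf G c → TreeOrLeaf G' (child c)
  child-TreeOrLeaf x {c} x→c c-tl with c ≟ u | c ≟ v
  ... | yes refl | _ = Neighbourhood.TreeOrLeaf-transfer w' x (λ _ → x→c) w-TreeOrLeaf
  ... | no _ | yes refl = ⊥-elim (reticulation⇒¬TreeOrLeaf v-ret c-tl)
  ... | no c≢u | no c≢v = Neighbourhood.TreeOrLeaf-transfer c' x ¬u→c c-tl
    where
    c' : V'
    c' = vertex c c≢u c≢v
    ¬u→c : E G u c → E G (value x) u
    ¬u→c u→c =
      ⊥-elim (value≢u x (w-sole-parent (subst (E G (value x)) (u-child≡w c' u→c) x→c)))

  ∖-IsTreeChild : IsTreeChild G'
  ∖-IsTreeChild = ∖-IsNetwork , tree-child'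
    where
    tree-child' : ∀ x → ¬ IsLeaf G' x → Σ V' λ c → E G' x c × TreeOrLeaf G' c
    tree-child' x x-inner with tree-child (value x) (λ leaf → x-inner (Children.none-transfer x leaf))
    ... | c , x→c , c-tl = child c , child-arc x c x→c , child-TreeOrLeaf x x→c c-tl

  record SuppressedTriangle (p w₁ k : V') : Set where
    constructor suppressed
    field
      p→u  : E G (value p) u
      u→w₁ : E G u (value w₁)
      w₁→k : E G (value w₁) (value k)
      p→k  : E G (value p) (value k)

  SuppressedTriangleOn : V' → V' → V' → Set
  SuppressedTriangleOn a b c =
    Σ V' λ p → Σ V' λ w₁ → Σ V' λ k → SuppressedTriangle p w₁ k × SameTriple a b c p w₁ k

  SuppressedTriangleOn-resp : ∀ {a b c a′ b′ c′} → SameTriple a b c a′ b′ c′ →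
    SuppressedTriangleOn a′ b′ c′ → SuppressedTriangleOn a b c
  SuppressedTriangleOn-resp same (p , w₁ , k , tri , same′) =
    p , w₁ , k , tri , SameTriple-trans same same′

  via-u-in-triangle : (x y t : V') → x ≢ y → x ≢ t → y ≢ t → E G (value x) u → E G u (value y) →
    Adj G' y t → Adj G' x t → E G (value y) (value t) × E G (value x) (value t)
  via-u-in-triangle x y t x≢y x≢t y≢t x→u u→y y-t x-t = y→t , x→t
    where
    y≡w : value y ≡ w
    y≡w = u-child≡w y u→y

    ¬t→'y : ArcView t y → ⊥
    ¬t→'y (old t→y) = value≢u t (w-sole-parent (subst (E G (value t)) y≡w t→y))
    ¬t→'y (via-u t→u _) = x≢t (value-injective (u-parent-unique x→u t→u))
    ¬t→'y (via-v _ v→y) = u≢v (sym (w-sole-parent (subst (E G v) y≡w v→y)))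

    y→'t : E G' y t
    y→'t = [ id , (λ t→y → ⊥-elim (¬t→'y (view t y t→y))) ]′ y-t

    x→'t : E G' x t
    x→'t = [ id , (λ t→x → ⊥-elim (no-3-cycle' x y t (via-u-arc x y x→u u→y) y→'t t→x)) ]′ x-t

    y→t : E G (value y) (value t)
    y→t with view y t y→'t
    ... | old y→t′ = y→t′
    ... | via-u y→u _ = ⊥-elim (no-2-cycle u→y y→u)
    ... | via-v y→v v→t with view x t x→'t
    ...   | old x→t = ⊥-elim (value≢v x (v-child-sole-parent v→t x→t))
    ...   | via-u _ u→t = ⊥-elim (u≢v (v-child-sole-parent v→t u→t))
    ...   | via-v x→v _ =
            ⊥-elim (value-≢ x≢y (trans (v-parent≡q x x→v) (sym (v-parent≡q y y→v))))

    x→t : E G (value x) (value t)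
    x→t with view x t x→'t
    ... | old x→t′ = x→t′
    ... | via-u _ u→t = ⊥-elim (y≢t (value-injective (trans y≡w (sym (u-child≡w t u→t)))))
    ... | via-v _ v→t = ⊥-elim (value≢v y (v-child-sole-parent v→t y→t))

  via-v-not-in-triangle : (x y t : V') → x ≢ y → x ≢ t → y ≢ t → E G (value x) v → E G v (value y) →
    Adj G' y t → Adj G' x t → ⊥
  via-v-not-in-triangle x y t x≢y x≢t y≢t x→v v→y y-t x-t = y→'t-cases (view y t y→'t)
    where
    ¬t→'y : ArcView t y → ⊥
    ¬t→'y (old t→y) = value≢v t (v-child-sole-parent v→y t→y)
    ¬t→'y (via-u _ u→y) = u≢v (v-child-sole-parent v→y u→y)
    ¬t→'y (via-v t→v _) = value-≢ x≢t (trans (v-parent≡q x x→v) (sym (v-parent≡q t t→v)))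

    y→'t : E G' y t
    y→'t = [ id , (λ t→y → ⊥-elim (¬t→'y (view t y t→y))) ]′ y-t

    x→'t : E G' x t
    x→'t = [ id , (λ t→x → ⊥-elim (no-3-cycle' x y t (via-v-arc x y x→v v→y) y→'t t→x)) ]′ x-t

    t-TreeOrLeaf : ∀ {a} → E G a v → E G a (value t) → TreeOrLeaf G (value t)
    t-TreeOrLeaf a→v a→t = reticulation-sibling-TreeOrLeaf v-ret a→v a→t (value≢v t)

    x→'t-given-y→t : E G (value y) (value t) → ArcView x t → ⊥
    x→'t-given-y→t y→t (old x→t) =
      two-parents⇒¬TreeOrLeaf y→t x→t (value-≢ (≢-sym x≢y)) (t-TreeOrLeaf x→v x→t)
    x→'t-given-y→t y→t (via-u _ u→t) =
      two-parents⇒¬TreeOrLeaf y→t u→t (value≢u y) (t-TreeOrLeaf u→v u→t)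
    x→'t-given-y→t _ (via-v _ v→t) = value-≢ y≢t (trans (v-child≡z v→y) (sym (v-child≡z v→t)))

    y→'t-cases : ArcView y t → ⊥
    y→'t-cases (old y→t) = x→'t-given-y→t y→t (view x t x→'t)
    y→'t-cases (via-u y→u _) = no-3-cycle u→v v→y y→u
    y→'t-cases (via-v y→v _) = no-2-cycle v→y y→v

  arc-in-triangle : (x y t : V') → x ≢ y → x ≢ t → y ≢ t → E G' x y → Adj G' y t → Adj G' x t →
    E G (value x) (value y) ⊎ SuppressedTriangle x y t
  arc-in-triangle x y t x≢y x≢t y≢t x→y y-t x-t with view x y x→y
  ... | old x→y′ = inj₁ x→y′
  ... | via-u x→u u→y = inj₂ (suppressed x→u u→y y→t x→t)
    where
    y→t×x→t : E G (value y) (value t) × E G (value x) (value t)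
    y→t×x→t = via-u-in-triangle x y t x≢y x≢t y≢t x→u u→y y-t x-t
    y→t : E G (value y) (value t)
    y→t = proj₁ y→t×x→t
    x→t : E G (value x) (value t)
    x→t = proj₂ y→t×x→t
  ... | via-v x→v v→y = ⊥-elim (via-v-not-in-triangle x y t x≢y x≢t y≢t x→v v→y y-t x-t)

  first-side-of-three-cycle : ∀ {a b c} → IsThreeCycle G' a b c →
    Adj G (value a) (value b) ⊎ SuppressedTriangleOn a b c
  first-side-of-three-cycle {a} {b} {c} (a≢b , b≢c , a≢c , a-b , b-c , a-c) with a-b
  ... | inj₁ a→b = ⊎-map inj₁ (λ tri → a , b , c , tri , SameTriple-refl)
                     (arc-in-triangle a b c a≢b a≢c b≢c a→b b-c a-c)
  ... | inj₂ b→a = ⊎-map inj₂ (λ tri → b , a , c , tri , SameTriple-swap₁₂)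
                     (arc-in-triangle b a c (≢-sym a≢b) b≢c a≢c b→a a-c b-c)

  three-cycle-classification : ∀ {a b c} → IsThreeCycle G' a b c →
    IsThreeCycle G (value a) (value b) (value c) ⊎ SuppressedTriangleOn a b c
  three-cycle-classification cyc@(a≢b , b≢c , a≢c , _)
    with first-side-of-three-cycle cyc
       | first-side-of-three-cycle (IsThreeCycle-rotate cyc)
       | first-side-of-three-cycle (IsThreeCycle-swap₂₃ cyc)
  ... | inj₂ tri | _ | _ = inj₂ tri
  ... | inj₁ _ | inj₂ tri | _ = inj₂ (SuppressedTriangleOn-resp SameTriple-rotate tri)
  ... | inj₁ _ | inj₁ _ | inj₂ tri = inj₂ (SuppressedTriangleOn-resp SameTriple-swap₂₃ tri)
  ... | inj₁ a-b | inj₁ b-c | inj₁ a-c =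
        inj₁ (value-≢ a≢b , value-≢ b≢c , value-≢ a≢c , a-b , b-c , a-c)

  ∖-¬HasThreeCycle : ThreeCyclesThrough G u →
    (∀ p w₁ k → E G p u → E G u w₁ → w₁ ≢ v → E G w₁ k → E G p k → ⊥) →
    ¬ HasThreeCycle G'
  ∖-¬HasThreeCycle through-u no-triangle (a , b , c , cyc) with three-cycle-classification cyc
  ... | inj₁ cycG =
        [ value≢u a ∘ sym , [ value≢u b ∘ sym , value≢u c ∘ sym ]′ ]′ (through-u _ _ _ cycG)
  ... | inj₂ (p , w₁ , k , suppressed p→u u→w₁ w₁→k p→k , _) =
        no-triangle (value p) (value w₁) (value k) p→u u→w₁ (value≢v w₁) w₁→k p→k

  three-cycles-through : ¬ HasThreeCycle G → ∀ {P W K} → SuppressedTriangle P W K →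
    ∀ a b c → IsThreeCycle G' a b c → OnTriple G' a b c P × OnTriple G' a b c W
  three-cycles-through no-cycle {P} {W} (suppressed P→u u→W _ _) a b c cyc
    with three-cycle-classification cyc
  ... | inj₁ cycG = ⊥-elim (no-cycle (_ , _ , _ , cycG))
  ... | inj₂ (p , w₁ , _ , suppressed p→u u→w₁ _ _ , _ , (p-on , w₁-on , _)) =
        subst (OnTriple G' a b c) (value-injective p≡P) p-on ,
        subst (OnTriple G' a b c) (value-injective w₁≡W) w₁-on
    where
    p≡P : value p ≡ value P
    p≡P = u-parent-unique p→u P→u
    w₁≡W : value w₁ ≡ value W
    w₁≡W = trans (u-child≡w w₁ u→w₁) (sym (u-child≡w W u→W))

module TransitiveTriangle (G : DiGraph) (tc : IsTreeChild G) {P W K : V G}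
                          (P→W : E G P W) (W→K : E G W K) (P→K : E G P K) where
  open TreeChild G tc P→W

  P≢W : P ≢ W
  P≢W = arc⇒≢ P→W

  W≢K : W ≢ K
  W≢K = arc⇒≢ W→K

  K-IsReticulation : IsReticulation G K
  K-IsReticulation = two-parents⇒reticulation P→K W→K P≢W

  K-¬TreeOrLeaf : ¬ TreeOrLeaf G K
  K-¬TreeOrLeaf = two-parents⇒¬TreeOrLeaf P→K W→K P≢W

  reticulation-arcs : ∀ {f₁ f₂} → E G f₁ f₂ → IsReticulation G f₂ →
    OnTriple G P W K f₁ → OnTriple G P W K f₂ → f₁ ≡ P × f₂ ≡ K ⊎ f₁ ≡ W × f₂ ≡ K
  reticulation-arcs f₁→P _ (inj₁ refl) (inj₁ refl) = ⊥-elim (no-loop f₁→P)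
  reticulation-arcs f₁→P _ (inj₂ (inj₁ refl)) (inj₁ refl) = ⊥-elim (no-2-cycle P→W f₁→P)
  reticulation-arcs f₁→P _ (inj₂ (inj₂ refl)) (inj₁ refl) = ⊥-elim (no-2-cycle P→K f₁→P)
  reticulation-arcs _ W-ret _ (inj₂ (inj₁ refl)) =
    ⊥-elim (K-¬TreeOrLeaf (reticulation-child-TreeOrLeaf W-ret W→K))
  reticulation-arcs _ _ (inj₁ refl) (inj₂ (inj₂ refl)) = inj₁ (refl , refl)
  reticulation-arcs _ _ (inj₂ (inj₁ refl)) (inj₂ (inj₂ refl)) = inj₂ (refl , refl)
  reticulation-arcs f₁→K _ (inj₂ (inj₂ refl)) (inj₂ (inj₂ refl)) = ⊥-elim (no-loop f₁→K)

  ∖PK-¬HasThreeCycle : ThreeCyclesThrough G P → ¬ HasThreeCycle (G ∖ (P , K))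
  ∖PK-¬HasThreeCycle through-P =
    ArcDeletion.∖-¬HasThreeCycle G tc P→K K-IsReticulation through-P no-triangle
    where
    -- The children of P are W and K, so t = W. If k = K then x ∈ {P, W} closes a directed
    -- cycle with x → P; otherwise W has the two reticulation children K and k.
    no-triangle : ∀ x t k → E G x P → E G P t → t ≢ K → E G t k → E G x k → ⊥
    no-triangle x t k x→P P→t t≢K t→k x→k with children-third P→W P→K P→t W≢K
    ... | inj₂ t≡K = t≢K t≡K
    ... | inj₁ refl with k ≟ K
    ...   | yes refl = [ (λ x≡P → no-loop (subst (λ a → E G a P) x≡P x→P)) ,
                         (λ x≡W → no-2-cycle P→W (subst (λ a → E G a P) x≡W x→P)) ]′
                       (parents-third P→K W→K x→k P≢W)
    ...   | no k≢K = [ K-¬TreeOrLeaf , two-parents⇒¬TreeOrLeaf t→k x→k W≢x ]′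
                     (TreeOrLeaf-child W→K t→k (≢-sym k≢K))
      where
      W≢x : W ≢ x
      W≢x W≡x = no-2-cycle P→W (subst (λ a → E G a P) (sym W≡x) x→P)

  ∖WK-¬HasThreeCycle : ThreeCyclesThrough G W → ¬ HasThreeCycle (G ∖ (W , K))
  ∖WK-¬HasThreeCycle through-W =
    ArcDeletion.∖-¬HasThreeCycle G tc W→K K-IsReticulation through-W no-triangle
    where
    -- If x ≢ P, W has the two parents x, P but the two children t, K. If x = P, then k ∈ {W, K}
    -- is a child of P and t → k closes a directed cycle.
    no-triangle : ∀ x t k → E G x W → E G W t → t ≢ K → E G t k → E G x k → ⊥
    no-triangle x t k x→W W→t t≢K t→k x→k with x ≟ P
    ... | no x≢P = t≢K (two-parents⇒one-child x→W P→W x≢P W→t W→K)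
    ... | yes refl with children-third P→W P→K x→k W≢K
    ...   | inj₁ refl = no-2-cycle W→t t→k
    ...   | inj₂ refl = [ (λ t≡P → no-2-cycle P→W (subst (E G W) t≡P W→t)) ,
                          (λ t≡W → no-loop (subst (E G W) t≡W W→t)) ]′
                        (parents-third P→K W→K t→k P≢W)

module _ (N : DiGraph) (tc : IsTreeChild N) (no-cycle : ¬ HasThreeCycle N)
         {u v : V N} (u→v : E N u v) (v-ret : IsReticulation N v) where
  open ArcDeletion N tc u→v v-ret

  module _ {P W K : V'} (tri : SuppressedTriangle P W K) where

    open SuppressedTriangle tri

    P→W : E G' P W
    P→W = via-u-arc P W p→u u→w₁

    W→K : E G' W K
    W→K = old-arc W K w₁→k

    P→K : E G' P K
    P→K = old-arc P K p→k

    open TransitiveTriangle G' ∖-IsTreeChild {P} {W} {K} P→W W→K P→K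

    delete-triangle-arc : ∀ {f₁ f₂} → IsReticulationArc G' (f₁ , f₂) →
      OnTriple G' P W K f₁ → OnTriple G' P W K f₂ →
      IsTreeChild (G' ∖ (f₁ , f₂)) × ¬ HasThreeCycle (G' ∖ (f₁ , f₂))
    delete-triangle-arc {f₁} {f₂} (f₁→f₂ , f₂-ret) f₁-on f₂-on
      with reticulation-arcs {f₁} {f₂} f₁→f₂ f₂-ret f₁-on f₂-on
    ... | inj₁ (refl , refl) =
          ArcDeletion.∖-IsTreeChild G' ∖-IsTreeChild {P} {K} P→K K-IsReticulation ,
          ∖PK-¬HasThreeCycle (λ a b c cyc → proj₁ (three-cycles-through no-cycle tri a b c cyc))
    ... | inj₂ (refl , refl) =
          ArcDeletion.∖-IsTreeChild G' ∖-IsTreeChild {W} {K} W→K K-IsReticulation ,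
          ∖WK-¬HasThreeCycle (λ a b c cyc → proj₂ (three-cycles-through no-cycle tri a b c cyc))

  delete-reticulation-arc-of-three-cycle : ∀ {a b c} → IsThreeCycle G' a b c → ∀ {f₁ f₂} →
    IsReticulationArc G' (f₁ , f₂) → OnTriple G' a b c f₁ → OnTriple G' a b c f₂ →
    IsTreeChild (G' ∖ (f₁ , f₂)) × ¬ HasThreeCycle (G' ∖ (f₁ , f₂))
  delete-reticulation-arc-of-three-cycle {a} {b} {c} cyc f-ret f₁-on f₂-on
    with three-cycle-classification cyc
  ... | inj₁ cycN = ⊥-elim (no-cycle (_ , _ , _ , cycN))
  ... | inj₂ (P , W , K , tri , abc⊆PWK , _) =
        delete-triangle-arc tri f-ret (on-PWK f₁-on) (on-PWK f₂-on)
    where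
    on-PWK : ∀ {x} → OnTriple G' a b c x → OnTriple G' P W K x
    on-PWK = Triples.TripleSubset-OnTriple G' abc⊆PWK

lemma5 : (N : DiGraph) → IsTreeChild N → ¬ HasThreeCycle N →
    (e : V N × V N) → IsReticulationArc N e →
    (f f' : V (N ∖ e) × V (N ∖ e)) →
    HasThreeCycleWithRetArcs (N ∖ e) f f' →
    (IsTreeChild ((N ∖ e) ∖ f) × ¬ HasThreeCycle ((N ∖ e) ∖ f)) ×
    (IsTreeChild ((N ∖ e) ∖ f') × ¬ HasThreeCycle ((N ∖ e) ∖ f'))
lemma5 N tc no-cycle (u , v) (u→v , v-ret) (f₁ , f₂) (f₁′ , f₂′)
       (_ , f-ret , f′-ret , _ , _ , _ , cyc , f₁-on , f₂-on , f₁′-on , f₂′-on) =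
  delete-reticulation-arc-of-three-cycle N tc no-cycle u→v v-ret cyc f-ret f₁-on f₂-on ,
  delete-reticulation-arc-of-three-cycle N tc no-cycle u→v v-ret cyc f′-ret f₁′-on f₂′-on
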